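{- If $M(A)$ and $N(B)$ are matched matroids, then $(M\mathbin{\Join} N)^*=N^*\mathbin{\Join} M^*$.
   Context: $M.X$ denotes contraction of $M$ to $X$ (i.e. $M/(E-X)$), $M|X$ restriction. Matroids $M(A)$, $N(B)$ are matched if $M.(A\cap B)=N|(A\cap B)$; then $(N^*,M^*)$ is also matched. The free splice $M\mathbin{\Join} N$ of matched $M(A)$, $N(B)$ is the matroid on $A\cup B$ with rank function $r(X)=\min\{r_M(X\cap A)+|X-A|,\ r_N(X\cap B)+r_M(A-B)\}$. $M^*$ is the dual. -}

module Defs where

open import Data.Nat using (ℕ; _+_; _∸_; _≤_; _⊓_)
open import Data.Fin.Subset using (Subset; _⊆_; _∪_; _∩_; _─_; ∣_∣)
open import Relation.Binary.PropositionalEquality using (_≡_)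
open import Data.Product using (_×_)

-- Ground sets are finite subsets of a fixed finite universe Fin n.
-- A "raw matroid" is a ground set together with a rank function
-- (only its values on subsets of the ground set are meaningful).
record RawMatroid (n : ℕ) : Set where
  field
    ground : Subset n
    rank   : Subset n → ℕ
open RawMatroid public

record IsMatroid {n : ℕ} (M : RawMatroid n) : Set where
  field
    R1 : ∀ X → X ⊆ ground M → rank M X ≤ ∣ X ∣
    R2 : ∀ X Y → X ⊆ Y → Y ⊆ ground M → rank M X ≤ rank M Y
    R3 : ∀ X Y → X ⊆ ground M → Y ⊆ ground M →
         rank M (X ∪ Y) + rank M (X ∩ Y) ≤ rank M X + rank M Y

record Matroid (n : ℕ) : Set where
  field
    raw      : RawMatroid n
    isMatroid : IsMatroid raw
open Matroid public

_≈ₘ_ : {n : ℕ} → RawMatroid n → RawMatroid n → Set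
M ≈ₘ N = (ground M ≡ ground N) × (∀ X → X ⊆ ground M → rank M X ≡ rank N X)

-- Dual: r*(X) = |X| + r(E - X) - r(E)  (the subtraction is exact for matroids)
dual : {n : ℕ} → RawMatroid n → RawMatroid n
dual M = record
  { ground = ground M
  ; rank   = λ X → (∣ X ∣ + rank M (ground M ─ X)) ∸ rank M (ground M)
  }

-- Contraction to X:  M.X = M/(E - X), rank Y ↦ r(Y ∪ (E - X)) - r(E - X)
contractTo : {n : ℕ} → RawMatroid n → Subset n → RawMatroid n
contractTo M X = record
  { ground = X
  ; rank   = λ Y → rank M (Y ∪ (ground M ─ X)) ∸ rank M (ground M ─ X)
  }

restrictTo : {n : ℕ} → RawMatroid n → Subset n → RawMatroid n
restrictTo N X = record { ground = X ; rank = rank N }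

Matched : {n : ℕ} → RawMatroid n → RawMatroid n → Set
Matched M N = contractTo M (ground M ∩ ground N) ≈ₘ restrictTo N (ground M ∩ ground N)

splice : {n : ℕ} → RawMatroid n → RawMatroid n → RawMatroid n
splice M N = record
  { ground = ground M ∪ ground N
  ; rank   = λ X → (rank M (X ∩ ground M) + ∣ X ─ ground M ∣)
                   ⊓ (rank N (X ∩ ground N) + rank M (ground M ─ ground N))
  }

-- Write E = A ∪ B.  Matchedness says r_N(A ∩ B) + r_M(A − B) = r_M(A); with submodularity of
-- r_N this makes the N-branch the smaller one at E, so the splice has rank r_N(B) + r_M(A − B).
-- The dual rank r*(X) = |X| + r(E − X) − r(E) is then compared with the rank of N* ⋈ M*
-- branch by branch: the N-branch at E − X matches the N*-branch at X, and the M-branch at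
-- E − X matches the M*-branch at X.  Both follow from |X| = |X ∩ A| + |X − A| (resp. B) and
-- the exact form r*(Y) + r(F) = |Y| + r(F − Y) of the dual rank in M and N.
module Submission where

open import Data.Nat using (ℕ; suc; _+_; _∸_; _≤_; _⊓_)
open import Data.Nat.Properties
  using (+-suc; +-assoc; +-comm; +-monoˡ-≤; m≤m+n; m∸n+n≡m; m+n∸n≡m;
         m≥n⇒m⊓n≡n; ⊓-comm; +-distribˡ-⊓; +-distribʳ-⊓; module ≤-Reasoning)
open import Data.Nat.Tactic.RingSolver using (solve)
open import Data.Fin.Subset using (Subset; inside; outside; _⊆_; _∪_; _∩_; _─_; ∣_∣)
open import Data.Fin.Subset.Properties
  using (⊆-refl; drop-∷-⊆; p∩q⊆p; ∣p∩q∣≤∣q∣; p─q⊆p; p─q─r≡p─r─q;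
         ∩-comm; ∪-comm; ∩-abs-∪)
open import Data.Product using (_,_; proj₂)
open import Relation.Nullary using (contradiction)
open import Relation.Binary.PropositionalEquality
  using (_≡_; refl; sym; trans; cong; cong₂; module ≡-Reasoning)

open import Defs

-- Data.Vec and Data.List are opened in separate local modules: with both sets of constructors
-- in scope, the list literals given to solve below are ambiguous and checking becomes very slow.
module _ where
  open import Data.Vec using ([]; _∷_; here)

  p∩q∪[p─q]≡p : ∀ {n} (p q : Subset n) → p ∩ q ∪ (p ─ q) ≡ p
  p∩q∪[p─q]≡p []            []            = refl
  p∩q∪[p─q]≡p (inside  ∷ p) (inside  ∷ q) = cong (inside ∷_) (p∩q∪[p─q]≡p p q)
  p∩q∪[p─q]≡p (inside  ∷ p) (outside ∷ q) = cong (inside ∷_) (p∩q∪[p─q]≡p p q)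
  p∩q∪[p─q]≡p (outside ∷ p) (inside  ∷ q) = cong (outside ∷_) (p∩q∪[p─q]≡p p q)
  p∩q∪[p─q]≡p (outside ∷ p) (outside ∷ q) = cong (outside ∷_) (p∩q∪[p─q]≡p p q)

  [p∪q]∩p≡p : ∀ {n} (p q : Subset n) → (p ∪ q) ∩ p ≡ p
  [p∪q]∩p≡p p q = trans (∩-comm (p ∪ q) p) (∩-abs-∪ p q)

  [p∪q]∩q≡q : ∀ {n} (p q : Subset n) → (p ∪ q) ∩ q ≡ q
  [p∪q]∩q≡q p q = trans (cong (_∩ q) (∪-comm p q)) ([p∪q]∩p≡p q p)

  p∪q─p≡q─p : ∀ {n} (p q : Subset n) → p ∪ q ─ p ≡ q ─ p
  p∪q─p≡q─p []            []      = refl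
  p∪q─p≡q─p (inside  ∷ p) (y ∷ q) = cong (outside ∷_) (p∪q─p≡q─p p q)
  p∪q─p≡q─p (outside ∷ p) (y ∷ q) = cong (y ∷_) (p∪q─p≡q─p p q)

  [p─q]∩r≡p∩r─q : ∀ {n} (p q r : Subset n) → (p ─ q) ∩ r ≡ p ∩ r ─ q
  [p─q]∩r≡p∩r─q []      []            []      = refl
  [p─q]∩r≡p∩r─q (x ∷ p) (inside  ∷ q) (z ∷ r) = cong (outside ∷_) ([p─q]∩r≡p∩r─q p q r)
  [p─q]∩r≡p∩r─q (x ∷ p) (outside ∷ q) (z ∷ r) = cong (_ ∷_) ([p─q]∩r≡p∩r─q p q r)

  p─q∩p≡p─q : ∀ {n} (p q : Subset n) → p ─ q ∩ p ≡ p ─ q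
  p─q∩p≡p─q []            []            = refl
  p─q∩p≡p─q (inside  ∷ p) (inside  ∷ q) = cong (outside ∷_) (p─q∩p≡p─q p q)
  p─q∩p≡p─q (outside ∷ p) (inside  ∷ q) = cong (outside ∷_) (p─q∩p≡p─q p q)
  p─q∩p≡p─q (x       ∷ p) (outside ∷ q) = cong (x ∷_) (p─q∩p≡p─q p q)

  p─[p─q]≡p∩q : ∀ {n} (p q : Subset n) → p ─ (p ─ q) ≡ p ∩ q
  p─[p─q]≡p∩q []            []            = refl
  p─[p─q]≡p∩q (inside  ∷ p) (inside  ∷ q) = cong (inside ∷_) (p─[p─q]≡p∩q p q)
  p─[p─q]≡p∩q (inside  ∷ p) (outside ∷ q) = cong (outside ∷_) (p─[p─q]≡p∩q p q)
  p─[p─q]≡p∩q (outside ∷ p) (inside  ∷ q) = cong (outside ∷_) (p─[p─q]≡p∩q p q)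
  p─[p─q]≡p∩q (outside ∷ p) (outside ∷ q) = cong (outside ∷_) (p─[p─q]≡p∩q p q)

  ∣p∣≡∣p∩q∣+∣p─q∣ : ∀ {n} (p q : Subset n) → ∣ p ∣ ≡ ∣ p ∩ q ∣ + ∣ p ─ q ∣
  ∣p∣≡∣p∩q∣+∣p─q∣ []            []            = refl
  ∣p∣≡∣p∩q∣+∣p─q∣ (inside  ∷ p) (inside  ∷ q) = cong suc (∣p∣≡∣p∩q∣+∣p─q∣ p q)
  ∣p∣≡∣p∩q∣+∣p─q∣ (inside  ∷ p) (outside ∷ q) =
    trans (cong suc (∣p∣≡∣p∩q∣+∣p─q∣ p q)) (sym (+-suc _ _))
  ∣p∣≡∣p∩q∣+∣p─q∣ (outside ∷ p) (inside  ∷ q) = ∣p∣≡∣p∩q∣+∣p─q∣ p q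
  ∣p∣≡∣p∩q∣+∣p─q∣ (outside ∷ p) (outside ∷ q) = ∣p∣≡∣p∩q∣+∣p─q∣ p q

  p⊆q∪r⇒∣p─q∣+∣r─q─p∣≡∣r─q∣ : ∀ {n} (p q r : Subset n) → p ⊆ q ∪ r →
                              ∣ p ─ q ∣ + ∣ r ─ q ─ p ∣ ≡ ∣ r ─ q ∣
  p⊆q∪r⇒∣p─q∣+∣r─q─p∣≡∣r─q∣ [] [] [] _ = refl
  p⊆q∪r⇒∣p─q∣+∣r─q─p∣≡∣r─q∣ (inside ∷ p) (inside ∷ q) (z ∷ r) p⊆q∪r =
    p⊆q∪r⇒∣p─q∣+∣r─q─p∣≡∣r─q∣ p q r (drop-∷-⊆ p⊆q∪r)
  p⊆q∪r⇒∣p─q∣+∣r─q─p∣≡∣r─q∣ (outside ∷ p) (inside ∷ q) (z ∷ r) p⊆q∪r =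
    p⊆q∪r⇒∣p─q∣+∣r─q─p∣≡∣r─q∣ p q r (drop-∷-⊆ p⊆q∪r)
  p⊆q∪r⇒∣p─q∣+∣r─q─p∣≡∣r─q∣ (inside ∷ p) (outside ∷ q) (inside ∷ r) p⊆q∪r =
    cong suc (p⊆q∪r⇒∣p─q∣+∣r─q─p∣≡∣r─q∣ p q r (drop-∷-⊆ p⊆q∪r))
  p⊆q∪r⇒∣p─q∣+∣r─q─p∣≡∣r─q∣ (inside ∷ p) (outside ∷ q) (outside ∷ r) p⊆q∪r =
    contradiction (p⊆q∪r here) λ ()
  p⊆q∪r⇒∣p─q∣+∣r─q─p∣≡∣r─q∣ (outside ∷ p) (outside ∷ q) (inside ∷ r) p⊆q∪r =
    trans (+-suc _ _) (cong suc (p⊆q∪r⇒∣p─q∣+∣r─q─p∣≡∣r─q∣ p q r (drop-∷-⊆ p⊆q∪r)))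
  p⊆q∪r⇒∣p─q∣+∣r─q─p∣≡∣r─q∣ (outside ∷ p) (outside ∷ q) (outside ∷ r) p⊆q∪r =
    p⊆q∪r⇒∣p─q∣+∣r─q─p∣≡∣r─q∣ p q r (drop-∷-⊆ p⊆q∪r)

module _ {n : ℕ} (M : Matroid n) where
  open IsMatroid (isMatroid M)
  private
    E : Subset n
    E = ground (raw M)
    r : Subset n → ℕ
    r = rank (raw M)

  rank-∪-≤ : ∀ P Q → P ⊆ E → Q ⊆ E → r (P ∪ Q) ≤ ∣ P ∣ + r Q
  rank-∪-≤ P Q P⊆E Q⊆E = begin
    r (P ∪ Q)             ≤⟨ m≤m+n _ _ ⟩
    r (P ∪ Q) + r (P ∩ Q) ≤⟨ R3 P Q P⊆E Q⊆E ⟩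
    r P + r Q             ≤⟨ +-monoˡ-≤ (r Q) (R1 P P⊆E) ⟩
    ∣ P ∣ + r Q           ∎
    where open ≤-Reasoning

  rank-ground-≤ : ∀ X → r E ≤ ∣ X ∣ + r (E ─ X)
  rank-ground-≤ X = begin
    r E                   ≡⟨ cong r (p∩q∪[p─q]≡p E X) ⟨
    r (E ∩ X ∪ (E ─ X))   ≤⟨ rank-∪-≤ (E ∩ X) (E ─ X) (p∩q⊆p E X) (p─q⊆p E X) ⟩
    ∣ E ∩ X ∣ + r (E ─ X) ≤⟨ +-monoˡ-≤ (r (E ─ X)) (∣p∩q∣≤∣q∣ E X) ⟩
    ∣ X ∣ + r (E ─ X)     ∎
    where open ≤-Reasoning

  dual-rank-+-rank-ground : ∀ X → rank (dual (raw M)) X + r E ≡ ∣ X ∣ + r (E ─ X)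
  dual-rank-+-rank-ground X = m∸n+n≡m (rank-ground-≤ X)

  dual-rank-∩-+-rank-ground : ∀ X → rank (dual (raw M)) (X ∩ E) + r E ≡ ∣ X ∩ E ∣ + r (E ─ X)
  dual-rank-∩-+-rank-ground X =
    trans (dual-rank-+-rank-ground (X ∩ E)) (cong (λ Y → ∣ X ∩ E ∣ + r Y) (p─q∩p≡p─q E X))

module _ {n : ℕ} (M N : RawMatroid n) where
  private
    A B : Subset n
    A = ground M
    B = ground N

  splice-rank-─ : ∀ X → rank (splice M N) (A ∪ B ─ X) ≡
                  (rank M (A ─ X) + ∣ B ─ A ─ X ∣) ⊓ (rank N (B ─ X) + rank M (A ─ B))
  splice-rank-─ X =
    cong₂ _⊓_ (cong₂ _+_ (cong (rank M) [E─X]∩A≡A─X) (cong ∣_∣ E─X─A≡B─A─X))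
              (cong (λ Y → rank N Y + rank M (A ─ B)) [E─X]∩B≡B─X)
    where
    [E─X]∩A≡A─X : (A ∪ B ─ X) ∩ A ≡ A ─ X
    [E─X]∩A≡A─X = trans ([p─q]∩r≡p∩r─q (A ∪ B) X A) (cong (_─ X) ([p∪q]∩p≡p A B))
    [E─X]∩B≡B─X : (A ∪ B ─ X) ∩ B ≡ B ─ X
    [E─X]∩B≡B─X = trans ([p─q]∩r≡p∩r─q (A ∪ B) X B) (cong (_─ X) ([p∪q]∩q≡q A B))
    E─X─A≡B─A─X : A ∪ B ─ X ─ A ≡ B ─ A ─ X
    E─X─A≡B─A─X = trans (p─q─r≡p─r─q (A ∪ B) X A) (cong (_─ X) (p∪q─p≡q─p A B))

module _ {n : ℕ} (M : Matroid n) (N : RawMatroid n) (matched : Matched (raw M) N) where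
  private
    A B : Subset n
    A = ground (raw M)
    B = ground N
    rM : Subset n → ℕ
    rM = rank (raw M)

  matched-rank : rank N (A ∩ B) + rM (A ─ B) ≡ rM A
  matched-rank = begin
    rank N (A ∩ B) + rM (A ─ B)
      ≡⟨ cong (_+ rM (A ─ B)) contracted ⟨
    rM (A ∩ B ∪ (A ─ A ∩ B)) ∸ rM (A ─ A ∩ B) + rM (A ─ B)
      ≡⟨ cong (λ Y → rM (A ∩ B ∪ Y) ∸ rM Y + rM (A ─ B)) A─A∩B≡A─B ⟩
    rM (A ∩ B ∪ (A ─ B)) ∸ rM (A ─ B) + rM (A ─ B)
      ≡⟨ cong (λ Y → rM Y ∸ rM (A ─ B) + rM (A ─ B)) (p∩q∪[p─q]≡p A B) ⟩
    rM A ∸ rM (A ─ B) + rM (A ─ B)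
      ≡⟨ m∸n+n≡m (IsMatroid.R2 (isMatroid M) (A ─ B) A (p─q⊆p A B) ⊆-refl) ⟩
    rM A
      ∎
    where
    open ≡-Reasoning
    contracted : rM (A ∩ B ∪ (A ─ A ∩ B)) ∸ rM (A ─ A ∩ B) ≡ rank N (A ∩ B)
    contracted = proj₂ matched (A ∩ B) ⊆-refl
    A─A∩B≡A─B : A ─ A ∩ B ≡ A ─ B
    A─A∩B≡A─B = trans (cong (A ─_) (∩-comm A B)) (p─q∩p≡p─q A B)

module _ where
  open import Data.List using ([]; _∷_)

  N-branch-arithmetic : ∀ {x x₁ x₂ y m} d k →
    x ≡ x₁ + x₂ → d + k ≡ x₁ + y → x + (y + m) ≡ d + x₂ + (k + m)
  N-branch-arithmetic {x₁ = x₁} {x₂} {y} {m} d k refl d+k≡x₁+y = begin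
    x₁ + x₂ + (y + m) ≡⟨ solve (x₁ ∷ x₂ ∷ y ∷ m ∷ []) ⟩
    x₂ + (x₁ + y) + m ≡⟨ cong (λ t → x₂ + t + m) d+k≡x₁+y ⟨
    x₂ + (d + k) + m  ≡⟨ solve (x₂ ∷ d ∷ k ∷ m ∷ []) ⟩
    d + x₂ + (k + m)  ∎
    where open ≡-Reasoning

  M-branch-arithmetic : ∀ {x x₂ z b m} x₁ y d e k l w →
    x ≡ x₁ + x₂ → x₂ + z ≡ b → d + m ≡ x₁ + y → e + k ≡ b + l → l + w ≡ m →
    x + (y + z) ≡ d + e + (k + w)
  M-branch-arithmetic {x₂ = x₂} {z} x₁ y d e k l w refl refl d+m≡x₁+y e+k≡b+l refl = begin
    x₁ + x₂ + (y + z)      ≡⟨ solve (x₁ ∷ x₂ ∷ y ∷ z ∷ []) ⟩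
    x₁ + y + (x₂ + z)      ≡⟨ cong (_+ (x₂ + z)) d+m≡x₁+y ⟨
    d + (l + w) + (x₂ + z) ≡⟨ solve (d ∷ l ∷ w ∷ x₂ ∷ z ∷ []) ⟩
    d + (x₂ + z + l) + w   ≡⟨ cong (λ t → d + t + w) e+k≡b+l ⟨
    d + (e + k) + w        ≡⟨ solve (d ∷ e ∷ k ∷ w ∷ []) ⟩
    d + e + (k + w)        ∎
    where open ≡-Reasoning

module _ {n : ℕ} (M N : Matroid n) (matched : Matched (raw M) (raw N)) where
  private
    A B : Subset n
    A = ground (raw M)
    B = ground (raw N)
    rM rN : Subset n → ℕ
    rM = rank (raw M)
    rN = rank (raw N)
    M* N* S T : RawMatroid n
    M* = dual (raw M)
    N* = dual (raw N)
    S = splice (raw M) (raw N)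
    T = splice N* M*
    rank-E : ℕ
    rank-E = rN B + rM (A ─ B)

    B─[B─A]≡A∩B : B ─ (B ─ A) ≡ A ∩ B
    B─[B─A]≡A∩B = trans (p─[p─q]≡p∩q B A) (∩-comm B A)

  N-branch-≤-M-branch : rN B + rM (A ─ B) ≤ rM A + ∣ B ─ A ∣
  N-branch-≤-M-branch = begin
    rN B + rM (A ─ B)
      ≤⟨ +-monoˡ-≤ (rM (A ─ B)) (rank-ground-≤ N (B ─ A)) ⟩
    ∣ B ─ A ∣ + rN (B ─ (B ─ A)) + rM (A ─ B)
      ≡⟨ cong (λ Y → ∣ B ─ A ∣ + rN Y + rM (A ─ B)) B─[B─A]≡A∩B ⟩
    ∣ B ─ A ∣ + rN (A ∩ B) + rM (A ─ B)
      ≡⟨ +-assoc ∣ B ─ A ∣ _ _ ⟩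
    ∣ B ─ A ∣ + (rN (A ∩ B) + rM (A ─ B))
      ≡⟨ cong (∣ B ─ A ∣ +_) (matched-rank M (raw N) matched) ⟩
    ∣ B ─ A ∣ + rM A
      ≡⟨ +-comm ∣ B ─ A ∣ (rM A) ⟩
    rM A + ∣ B ─ A ∣
      ∎
    where open ≤-Reasoning

  splice-rank-ground : rank S (A ∪ B) ≡ rank-E
  splice-rank-ground = begin
    rank S (A ∪ B)                           ≡⟨ cong₂ _⊓_ M-branch N-branch ⟩
    (rM A + ∣ B ─ A ∣) ⊓ (rN B + rM (A ─ B)) ≡⟨ m≥n⇒m⊓n≡n N-branch-≤-M-branch ⟩
    rank-E                                   ∎
    where
    open ≡-Reasoning
    M-branch : rM ((A ∪ B) ∩ A) + ∣ A ∪ B ─ A ∣ ≡ rM A + ∣ B ─ A ∣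
    M-branch = cong₂ _+_ (cong rM ([p∪q]∩p≡p A B)) (cong ∣_∣ (p∪q─p≡q─p A B))
    N-branch : rN ((A ∪ B) ∩ B) + rM (A ─ B) ≡ rN B + rM (A ─ B)
    N-branch = cong (λ Y → rN Y + rM (A ─ B)) ([p∪q]∩q≡q A B)

  size-+-splice-rank-complement : ∀ X → X ⊆ A ∪ B →
    ∣ X ∣ + rank S (A ∪ B ─ X) ≡ rank T X + rank-E
  size-+-splice-rank-complement X X⊆A∪B = begin
    ∣ X ∣ + rank S (A ∪ B ─ X)
      ≡⟨ cong (∣ X ∣ +_) (splice-rank-─ (raw M) (raw N) X) ⟩
    ∣ X ∣ + ((rM (A ─ X) + ∣ B ─ A ─ X ∣) ⊓ (rN (B ─ X) + rM (A ─ B)))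
      ≡⟨ +-distribˡ-⊓ ∣ X ∣ _ _ ⟩
    (∣ X ∣ + (rM (A ─ X) + ∣ B ─ A ─ X ∣)) ⊓ (∣ X ∣ + (rN (B ─ X) + rM (A ─ B)))
      ≡⟨ cong₂ _⊓_ M-branch N-branch ⟩
    (tM + rank-E) ⊓ (tN + rank-E)
      ≡⟨ ⊓-comm (tM + rank-E) (tN + rank-E) ⟩
    (tN + rank-E) ⊓ (tM + rank-E)
      ≡⟨ +-distribʳ-⊓ rank-E tN tM ⟨
    rank T X + rank-E
      ∎
    where
    open ≡-Reasoning
    tN tM : ℕ
    tN = rank N* (X ∩ B) + ∣ X ─ B ∣
    tM = rank M* (X ∩ A) + rank N* (B ─ A)

    N-branch : ∣ X ∣ + (rN (B ─ X) + rM (A ─ B)) ≡ tN + rank-E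
    N-branch = N-branch-arithmetic (rank N* (X ∩ B)) (rN B)
                 (∣p∣≡∣p∩q∣+∣p─q∣ X B) (dual-rank-∩-+-rank-ground N X)

    M-branch : ∣ X ∣ + (rM (A ─ X) + ∣ B ─ A ─ X ∣) ≡ tM + rank-E
    M-branch = M-branch-arithmetic ∣ X ∩ A ∣ (rM (A ─ X)) (rank M* (X ∩ A)) (rank N* (B ─ A))
                 (rN B) (rN (A ∩ B)) (rM (A ─ B))
                 (∣p∣≡∣p∩q∣+∣p─q∣ X A) (p⊆q∪r⇒∣p─q∣+∣r─q─p∣≡∣r─q∣ X A B X⊆A∪B)
                 (dual-rank-∩-+-rank-ground M X) N*[B─A] (matched-rank M (raw N) matched)
      where
      N*[B─A] : rank N* (B ─ A) + rN B ≡ ∣ B ─ A ∣ + rN (A ∩ B)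
      N*[B─A] = trans (dual-rank-+-rank-ground N (B ─ A))
                      (cong (λ Y → ∣ B ─ A ∣ + rN Y) B─[B─A]≡A∩B)

  dual-splice-rank : ∀ X → X ⊆ A ∪ B → rank (dual S) X ≡ rank T X
  dual-splice-rank X X⊆A∪B = begin
    (∣ X ∣ + rank S (A ∪ B ─ X)) ∸ rank S (A ∪ B)
      ≡⟨ cong₂ _∸_ (size-+-splice-rank-complement X X⊆A∪B) splice-rank-ground ⟩
    (rank T X + rank-E) ∸ rank-E
      ≡⟨ m+n∸n≡m (rank T X) rank-E ⟩
    rank T X
      ∎
    where open ≡-Reasoning

proposition3p8 : (n : ℕ) (M N : Matroid n) → Matched (raw M) (raw N) →
    dual (splice (raw M) (raw N)) ≈ₘ splice (dual (raw N)) (dual (raw M))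
proposition3p8 n M N matched =
  ∪-comm (ground (raw M)) (ground (raw N)) , dual-splice-rank M N matched
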